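{- Let $m=2^\ell p_1^{a_1}\cdots p_k^{a_k}$ be the prime factorization of a positive integer $m$ (with $p_1,\dots,p_k$ distinct odd primes, $a_j\geq1$, $\ell\geq 0$), and let $m_0=\prod_{j:\,a_j \text{ odd}}p_j$ be the squarefree part of $p_1^{a_1}\cdots p_k^{a_k}$. Then $$ \mathbb{E}(\mathbb{X}(m))= \begin{cases} \displaystyle \frac{1}{m_0}(-1)^{\omega(m_0)}\prod_{\substack{1\leq j\leq k\\2\mid a_j}}\left(1-\frac{c(p_j)}{p_j}\right)\prod_{j=1}^k\left(1-\frac{c(p_j)}{p_j^2}\right)^{ -1} & \text{ if } \ell \text{ is even},\\ 0 & \text{ if } \ell \text{ is odd}. \end{cases} $$
   Context: $\omega(n)$ is the number of distinct prime factors of $n$. For a prime $p$ put $c(p)=1+\left(\frac{ -1}{p}\right)$. Let $\{\mathbb{X}(p)\}_p$ be independent random variables indexed by primes, where $\mathbb{X}(2)=\pm1$ each with probability $1/2$, and for odd $p$, $\mathbb{X}(p)$ takes the value $1$ with probability $\alpha_p=\frac12\left(1-\frac{c(p)+1}{p}\right)\left(1-\frac{c(p)}{p^2}\right)^{ -1}$, the value $-1$ with probability $\beta_p=\frac12\left(1-\frac{c(p)-1}{p}\right)\left(1-\frac{c(p)}{p^2}\right)^{ -1}$, and $0$ with probability $\gamma_p=1-\alpha_p-\beta_p$. Extend completely multiplicatively: $\mathbb{X}(1)=1$ and $\mathbb{X}(n)=\mathbb{X}(q_1)^{b_1}\cdots\mathbb{X}(q_r)^{b_r}$ for $n=q_1^{b_1}\cdots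 q_r^{b_r}$. -}

module Defs where

open import Data.Bool using (Bool; true; false; if_then_else_)
open import Data.Nat as ℕ using (ℕ; zero; suc; _∸_)
open import Data.Nat.Divisibility using (_∣?_)
open import Data.Nat.DivMod using (_/_)
open import Data.Nat.Primality using (prime?)
open import Data.Integer as ℤ using (ℤ; +_; -[1+_])
open import Data.Rational as ℚ using (ℚ; 0ℚ; 1ℚ; ½; 1/_; ≢-nonZero)
open import Data.Fin using (Fin; zero; suc)
open import Data.List using (List; []; _∷_; filter; upTo; length)
open import Data.Bool.ListAction using (any)
open import Data.Product using (_×_; _,_)
open import Relation.Nullary using (does; yes; no)
open import Relation.Binary.PropositionalEquality using (_≡_)

primesUpTo : ℕ → List ℕ
primesUpTo n = filter prime? (upTo (suc n))

-- multiplicity of q in n (fuel-bounded trial division; fuel n suffices)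
multAux : ℕ → ℕ → ℕ → ℕ
multAux zero    q n = 0
multAux (suc f) zero n = 0
multAux (suc f) (suc zero) n = 0
multAux (suc f) q@(suc (suc _)) zero = 0
multAux (suc f) q@(suc (suc _)) n@(suc _) =
  if does (q ∣? n) then suc (multAux f q (n / q)) else 0

mult : ℕ → ℕ → ℕ
mult q n = multAux n q n

ω : ℕ → ℕ
ω n = length (filter (λ q → q ∣? n) (primesUpTo n))

legendre : ℤ → ℕ → ℤ
legendre a p =
  if does (p ∣? ℤ.∣ a ∣) then + 0
  else if any (λ x → does (p ∣? ℤ.∣ (+ x) ℤ.* (+ x) ℤ.- a ∣)) (upTo p) then + 1
  else -[1+ 0 ]

c : ℕ → ℤ
c p = + 1 ℤ.+ legendre -[1+ 0 ] p

ℕ→ℚ : ℕ → ℚ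
ℕ→ℚ n = (+ n) ℚ./ 1

-- multiplicative inverse (0 ↦ 0); only applied to nonzero arguments below
inv : ℚ → ℚ
inv x with x ℚ.≟ 0ℚ
... | yes _ = 0ℚ
... | no x≢0 = 1/_ x {{≢-nonZero x≢0}}

_^ℚ_ : ℚ → ℕ → ℚ
x ^ℚ zero = 1ℚ
x ^ℚ suc n = x ℚ.* (x ^ℚ n)

prodFin : (k : ℕ) → (Fin k → ℚ) → ℚ
prodFin zero f = 1ℚ
prodFin (suc k) f = f zero ℚ.* prodFin k (λ j → f (suc j))

prodℕ : (k : ℕ) → (Fin k → ℕ) → ℕ
prodℕ zero f = 1
prodℕ (suc k) f = f zero ℕ.* prodℕ k (λ j → f (suc j))

-- distribution of 𝕏(p): list of (value, probability)
cℚ : ℕ → ℚ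
cℚ p = c p ℚ./ 1

αp βp γp : ℕ → ℚ
αp p = ½ ℚ.* (1ℚ ℚ.- (cℚ p ℚ.+ 1ℚ) ℚ.* inv (ℕ→ℚ p))
         ℚ.* inv (1ℚ ℚ.- cℚ p ℚ.* inv (ℕ→ℚ (p ℕ.^ 2)))
βp p = ½ ℚ.* (1ℚ ℚ.- (cℚ p ℚ.- 1ℚ) ℚ.* inv (ℕ→ℚ p))
         ℚ.* inv (1ℚ ℚ.- cℚ p ℚ.* inv (ℕ→ℚ (p ℕ.^ 2)))
γp p = 1ℚ ℚ.- αp p ℚ.- βp p

dist : ℕ → List (ℚ × ℚ)
dist 2 = (1ℚ , ½) ∷ (ℚ.- 1ℚ , ½) ∷ []
dist p = (1ℚ , αp p) ∷ (ℚ.- 1ℚ , βp p) ∷ (0ℚ , γp p) ∷ []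

-- an assignment of values to primes: a realisation of (𝕏(q))_q
Assignment : Set
Assignment = ℕ → ℚ

update : Assignment → ℕ → ℚ → Assignment
update f q v n = if does (n ℕ.≟ q) then v else f n

Xval : Assignment → ℕ → ℚ
Xval f n = go (primesUpTo n)
  where
  go : List ℕ → ℚ
  go [] = 1ℚ
  go (q ∷ qs) = (f q ^ℚ mult q n) ℚ.* go qs

-- expectation of F(𝕏) where F depends only on the primes in the list,
-- the 𝕏(q) being independent with laws dist q (iterated finite sum
-- over the product distribution)
expectOver : List ℕ → (Assignment → ℚ) → ℚ
expectOver [] F = F (λ _ → 1ℚ)
expectOver (q ∷ qs) F = sumDist (dist q)
  where
  sumDist : List (ℚ × ℚ) → ℚ
  sumDist [] = 0ℚ
  sumDist ((v , w) ∷ rest) =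
    w ℚ.* expectOver qs (λ g → F (update g q v)) ℚ.+ sumDist rest

-- 𝔼(𝕏(m)); 𝕏(m) depends only on 𝕏(q) for primes q ≤ m
E𝕏 : ℕ → ℚ
E𝕏 m = expectOver (primesUpTo m) (λ f → Xval f m)

-- Under the product law the values 𝕏(q) are independent, so 𝔼 𝕏(m) is the
-- product over the primes q ∣ m of 𝔼 𝕏(q)^{v_q(m)}; every other prime
-- contributes 𝔼 𝕏(q)⁰ = 1. At q = 2 the factor is (1 + (-1)^ℓ)/2, which is
-- 1 or 0 according to the parity of ℓ. At an odd p with exponent a ≥ 1 it is
-- α_p + (-1)^a β_p: for even a this is (1 - c(p)/p)(1 - c(p)/p²)⁻¹, for odd a
-- it is -(1/p)(1 - c(p)/p²)⁻¹. Collecting the factors 1/p and -1 over the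
-- odd exponents produces 1/m₀ and (-1)^{ω(m₀)}.
{-# OPTIONS --safe #-}
module Submission where

open import Defs
open import Data.Nat using (ℕ; zero; suc; _+_; _≤_; _^_; _*_; z≤n; s≤s; NonZero; >-nonZero)
import Data.Nat.Properties as ℕP
open import Algebra.Properties.CommutativeSemigroup ℕP.*-commutativeSemigroup using (x∙yz≈y∙xz)
open import Data.Nat.Divisibility
open import Data.Nat.DivMod using (_/_; m*[n/m]≡n; m/n<m)
open import Data.Nat.Primality using (Prime; prime[2]; prime?; euclidsLemma; prime⇒irreducible; prime⇒nonZero; prime⇒nonTrivial)
open import Data.Nat.Base using (nonTrivial⇒n>1)
import Data.Nat.Coprimality as Coprime
open import Data.Integer using (+_)
import Data.Integer.Properties as ℤP
open import Data.Fin using (Fin; zero; suc)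
import Data.Fin.Properties as FinP
open import Data.Bool using (true; false; if_then_else_)
open import Data.Rational using (ℚ; 0ℚ; 1ℚ; ½; mkℚ; _-_; -_)
open import Data.Rational as Q using ()
import Data.Rational.Properties as QP
open import Data.Rational.Solver using (module +-*-Solver)
open +-*-Solver
open import Data.List using (List; []; _∷_; filter; length; tabulate; upTo)
open import Data.List.Membership.Propositional using (_∈_; _∉_)
open import Data.List.Membership.Propositional.Properties using (∈-filter⁺; ∈-filter⁻; ∈-upTo⁺; ∈-tabulate⁺; ∈-tabulate⁻)
open import Data.List.Membership.DecPropositional ℕP._≟_ using (_∈?_)
import Data.List.Relation.Unary.All.Properties as AllP
open import Data.List.Relation.Unary.Any using (here; there)
open import Data.List.Relation.Unary.AllPairs using (_∷_)
open import Data.List.Relation.Unary.Unique.Propositional using (Unique)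
import Data.List.Relation.Unary.Unique.Propositional.Properties as UniqueP
open import Data.Product using (∃-syntax; _×_; _,_; proj₁; proj₂)
open import Data.Sum using (_⊎_; inj₁; inj₂)
open import Data.Empty using (⊥-elim)
open import Function using (_∘_)
open import Function.Definitions using (Injective)
open import Relation.Nullary using (¬_; yes; no; does; Dec)
open import Relation.Nullary.Decidable using (dec-true; dec-false)
open import Relation.Unary using (Decidable)
open import Relation.Binary.PropositionalEquality
open import Relation.Binary.Definitions using (tri<; tri≈; tri>)

if-dec : ∀ {A B : Set} (A? : Dec A) {x y : B} (P : B → Set) →
         (A → P x) → (¬ A → P y) → P (if does A? then x else y)
if-dec (yes a)  P Px Py = Px a
if-dec (no ¬a) P Px Py = Py ¬a

prodList : List ℕ → (ℕ → ℚ) → ℚ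
prodList []       h = 1ℚ
prodList (x ∷ xs) h = h x Q.* prodList xs h

prodList-cong : ∀ xs {h h′ : ℕ → ℚ} → (∀ {x} → x ∈ xs → h x ≡ h′ x) →
                prodList xs h ≡ prodList xs h′
prodList-cong []       h≡h′ = refl
prodList-cong (x ∷ xs) h≡h′ = cong₂ Q._*_ (h≡h′ (here refl)) (prodList-cong xs (h≡h′ ∘ there))

prodList-≡1 : ∀ xs {h : ℕ → ℚ} → (∀ {x} → x ∈ xs → h x ≡ 1ℚ) → prodList xs h ≡ 1ℚ
prodList-≡1 []       h≡1 = refl
prodList-≡1 (x ∷ xs) h≡1 = cong₂ Q._*_ (h≡1 (here refl)) (prodList-≡1 xs (h≡1 ∘ there))

prodList-tabulate : ∀ k (g : Fin k → ℕ) h → prodList (tabulate g) h ≡ prodFin k (λ j → h (g j))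
prodList-tabulate zero    g h = refl
prodList-tabulate (suc k) g h = cong (h (g zero) Q.*_) (prodList-tabulate k (λ j → g (suc j)) h)

update-same : ∀ (f : Assignment) q v → update f q v q ≡ v
update-same f q v rewrite dec-true (q ℕP.≟ q) refl = refl

update-other : ∀ (f : Assignment) q v {n} → n ≢ q → update f q v n ≡ f n
update-other f q v {n} n≢q rewrite dec-false (n ℕP.≟ q) n≢q = refl

prodList-extract : ∀ {xs} h {x} → Unique xs → x ∈ xs →
                   prodList xs h ≡ h x Q.* prodList xs (update h x 1ℚ)
prodList-extract {y ∷ ys} h u (here refl) =
  cong (h y Q.*_) (begin
    prodList ys h                           ≡⟨ prodList-cong ys (λ z∈ → sym (update-other h y 1ℚ (≢y z∈))) ⟩
    prodList ys (update h y 1ℚ)             ≡⟨ QP.*-identityˡ (prodList ys (update h y 1ℚ)) ⟨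
    1ℚ Q.* prodList ys (update h y 1ℚ)      ≡⟨ cong (Q._* prodList ys (update h y 1ℚ)) (update-same h y 1ℚ) ⟨
    prodList (y ∷ ys) (update h y 1ℚ)       ∎)
  where
  open ≡-Reasoning
  ≢y : ∀ {z} → z ∈ ys → z ≢ y
  ≢y z∈ refl = UniqueP.Unique[x∷xs]⇒x∉xs u z∈
prodList-extract {y ∷ ys} h {x} u@(_ ∷ uys) (there x∈) = begin
  h y Q.* prodList ys h                                 ≡⟨ cong (h y Q.*_) (prodList-extract h uys x∈) ⟩
  h y Q.* (h x Q.* prodList ys (update h x 1ℚ))         ≡⟨ solve 3 (λ a b c → a :* (b :* c) := b :* (a :* c)) refl (h y) (h x) _ ⟩
  h x Q.* (h y Q.* prodList ys (update h x 1ℚ))         ≡⟨ cong (λ t → h x Q.* (t Q.* _)) (update-other h x 1ℚ y≢x) ⟨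
  h x Q.* prodList (y ∷ ys) (update h x 1ℚ)             ∎
  where
  open ≡-Reasoning
  y≢x : y ≢ x
  y≢x refl = UniqueP.Unique[x∷xs]⇒x∉xs u x∈

prodList-reindex : ∀ xs {ys} h → Unique xs → Unique ys →
                   (∀ {x} → x ∈ xs → x ∉ ys → h x ≡ 1ℚ) →
                   (∀ {y} → y ∈ ys → y ∉ xs → h y ≡ 1ℚ) →
                   prodList xs h ≡ prodList ys h
prodList-reindex [] {ys} h _ _ _ onlyYs = sym (prodList-≡1 ys (λ y∈ → onlyYs y∈ λ ()))
prodList-reindex (x ∷ xs) {ys} h u@(_ ∷ uxs) uys onlyXs onlyYs with x ∈? ys
... | yes x∈ys = begin
  h x Q.* prodList xs h                   ≡⟨ cong (h x Q.*_) (prodList-cong xs (λ z∈ → sym (update-other h x 1ℚ (≢x z∈)))) ⟩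
  h x Q.* prodList xs (update h x 1ℚ)     ≡⟨ cong (h x Q.*_) (prodList-reindex xs (update h x 1ℚ) uxs uys onlyXs′ onlyYs′) ⟩
  h x Q.* prodList ys (update h x 1ℚ)     ≡⟨ prodList-extract h uys x∈ys ⟨
  prodList ys h                           ∎
  where
  open ≡-Reasoning
  ≢x : ∀ {z} → z ∈ xs → z ≢ x
  ≢x z∈ refl = UniqueP.Unique[x∷xs]⇒x∉xs u z∈
  onlyXs′ : ∀ {z} → z ∈ xs → z ∉ ys → update h x 1ℚ z ≡ 1ℚ
  onlyXs′ z∈ z∉ = trans (update-other h x 1ℚ (≢x z∈)) (onlyXs (there z∈) z∉)
  onlyYs′ : ∀ {y} → y ∈ ys → y ∉ xs → update h x 1ℚ y ≡ 1ℚ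
  onlyYs′ {y} y∈ y∉ with y ℕP.≟ x
  ... | yes refl = update-same h x 1ℚ
  ... | no y≢x   = trans (update-other h x 1ℚ y≢x)
                         (onlyYs y∈ λ { (here y≡x) → y≢x y≡x ; (there y∈xs) → y∉ y∈xs })
... | no x∉ys = begin
  h x Q.* prodList xs h     ≡⟨ cong (Q._* prodList xs h) (onlyXs (here refl) x∉ys) ⟩
  1ℚ Q.* prodList xs h      ≡⟨ QP.*-identityˡ (prodList xs h) ⟩
  prodList xs h             ≡⟨ prodList-reindex xs h uxs uys (onlyXs ∘ there) onlyYs′ ⟩
  prodList ys h             ∎
  where
  open ≡-Reasoning
  onlyYs′ : ∀ {y} → y ∈ ys → y ∉ xs → h y ≡ 1ℚ
  onlyYs′ y∈ y∉ = onlyYs y∈ λ { (here refl) → x∉ys y∈ ; (there y∈xs) → y∉ y∈xs }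

expect : List (ℚ × ℚ) → (ℚ → ℚ) → ℚ
expect []                K = 0ℚ
expect ((v , w) ∷ law) K = w Q.* K v Q.+ expect law K

expect-cong : ∀ law {K K′ : ℚ → ℚ} → (∀ v → K v ≡ K′ v) → expect law K ≡ expect law K′
expect-cong []              K≡K′ = refl
expect-cong ((v , w) ∷ law) K≡K′ = cong₂ (λ x y → w Q.* x Q.+ y) (K≡K′ v) (expect-cong law K≡K′)

expect-*ʳ : ∀ law K c → expect law (λ v → K v Q.* c) ≡ expect law K Q.* c
expect-*ʳ []              K c = sym (QP.*-zeroˡ c)
expect-*ʳ ((v , w) ∷ law) K c = begin
  w Q.* (K v Q.* c) Q.+ expect law (λ v → K v Q.* c)   ≡⟨ cong (w Q.* (K v Q.* c) Q.+_) (expect-*ʳ law K c) ⟩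
  w Q.* (K v Q.* c) Q.+ expect law K Q.* c             ≡⟨ solve 4 (λ w k c e → w :* (k :* c) :+ e :* c := (w :* k :+ e) :* c) refl w (K v) c (expect law K) ⟩
  (w Q.* K v Q.+ expect law K) Q.* c                   ∎
  where open ≡-Reasoning

-- The clauses only serve to make `dist q` reduce, after which the local sum
-- in `expectOver` unfolds to `expect`.
expectOver-∷ : ∀ q qs F →
  expectOver (q ∷ qs) F ≡ expect (dist q) (λ v → expectOver qs (λ g → F (update g q v)))
expectOver-∷ 0                   qs F = refl
expectOver-∷ 1                   qs F = refl
expectOver-∷ 2                   qs F = refl
expectOver-∷ (suc (suc (suc q))) qs F = refl

expectOver-cong : ∀ qs {F F′ : Assignment → ℚ} → (∀ f → F f ≡ F′ f) →
                  expectOver qs F ≡ expectOver qs F′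
expectOver-cong []       F≡F′ = F≡F′ _
expectOver-cong (q ∷ qs) {F} {F′} F≡F′ = begin
  expectOver (q ∷ qs) F                                       ≡⟨ expectOver-∷ q qs F ⟩
  expect (dist q) (λ v → expectOver qs (λ g → F (update g q v)))  ≡⟨ expect-cong (dist q) (λ v → expectOver-cong qs (λ g → F≡F′ (update g q v))) ⟩
  expect (dist q) (λ v → expectOver qs (λ g → F′ (update g q v))) ≡⟨ expectOver-∷ q qs F′ ⟨
  expectOver (q ∷ qs) F′                                      ∎
  where open ≡-Reasoning

expectOver-*ˡ : ∀ qs c F → expectOver qs (λ f → c Q.* F f) ≡ c Q.* expectOver qs F
expectOver-*ˡ []       c F = refl
expectOver-*ˡ (q ∷ qs) c F = begin
  expectOver (q ∷ qs) (λ f → c Q.* F f)                             ≡⟨ expectOver-∷ q qs _ ⟩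
  expect (dist q) (λ v → expectOver qs (λ g → c Q.* F (update g q v))) ≡⟨ expect-cong (dist q) (λ v → expectOver-*ˡ qs c _) ⟩
  expect (dist q) (λ v → c Q.* expectOver qs (λ g → F (update g q v))) ≡⟨ expect-cong (dist q) (λ v → QP.*-comm c _) ⟩
  expect (dist q) (λ v → expectOver qs (λ g → F (update g q v)) Q.* c) ≡⟨ expect-*ʳ (dist q) _ c ⟩
  expect (dist q) (λ v → expectOver qs (λ g → F (update g q v))) Q.* c ≡⟨ cong (Q._* c) (expectOver-∷ q qs F) ⟨
  expectOver (q ∷ qs) F Q.* c                                       ≡⟨ QP.*-comm _ c ⟩
  c Q.* expectOver (q ∷ qs) F                                       ∎
  where open ≡-Reasoning

expectOver-prodList : ∀ qs → Unique qs → (h : ℕ → ℚ → ℚ) →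
  expectOver qs (λ f → prodList qs (λ q → h q (f q))) ≡ prodList qs (λ q → expect (dist q) (h q))
expectOver-prodList []       _           h = refl
expectOver-prodList (q ∷ qs) u@(_ ∷ uqs) h = begin
  expectOver (q ∷ qs) (λ f → prodList (q ∷ qs) (λ r → h r (f r)))
    ≡⟨ expectOver-∷ q qs _ ⟩
  expect (dist q) (λ v → expectOver qs (λ g → h q (update g q v q) Q.* prodList qs (λ r → h r (update g q v r))))
    ≡⟨ expect-cong (dist q) (λ v → expectOver-cong qs (λ g →
         cong₂ Q._*_ (cong (h q) (update-same g q v)) (prodList-cong qs (cong (h _) ∘ update-other g q v ∘ ≢q)))) ⟩
  expect (dist q) (λ v → expectOver qs (λ g → h q v Q.* prodList qs (λ r → h r (g r))))
    ≡⟨ expect-cong (dist q) (λ v → expectOver-*ˡ qs (h q v) _) ⟩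
  expect (dist q) (λ v → h q v Q.* expectOver qs (λ g → prodList qs (λ r → h r (g r))))
    ≡⟨ expect-cong (dist q) (λ v → cong (h q v Q.*_) (expectOver-prodList qs uqs h)) ⟩
  expect (dist q) (λ v → h q v Q.* prodList qs (λ r → expect (dist r) (h r)))
    ≡⟨ expect-*ʳ (dist q) (h q) _ ⟩
  expect (dist q) (h q) Q.* prodList qs (λ r → expect (dist r) (h r))
    ∎
  where
  open ≡-Reasoning
  ≢q : ∀ {r} → r ∈ qs → r ≢ q
  ≢q r∈ refl = UniqueP.Unique[x∷xs]⇒x∉xs u r∈

prodList-unique : ∀ (h : ℕ → ℚ) {G : List ℕ → ℚ} → G [] ≡ 1ℚ →
                  (∀ x xs → G (x ∷ xs) ≡ h x Q.* G xs) → ∀ xs → G xs ≡ prodList xs h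
prodList-unique h G[] G∷ []       = G[]
prodList-unique h G[] G∷ (x ∷ xs) = trans (G∷ x xs) (cong (h x Q.*_) (prodList-unique h G[] G∷ xs))

-- `Xval` folds over the primes with a local function, which can only be
-- reached by abstracting over the list.
Xval-prodList : ∀ f n → Xval f n ≡ prodList (primesUpTo n) (λ q → f q ^ℚ mult q n)
Xval-prodList f n with primesUpTo n | prodList-unique (λ q → f q ^ℚ mult q n) refl (λ _ _ → refl)
... | qs | fold≡prodList = fold≡prodList qs

primesUpTo-unique : ∀ n → Unique (primesUpTo n)
primesUpTo-unique n = UniqueP.filter⁺ prime? (UniqueP.upTo⁺ (suc n))

E𝕏-prodList : ∀ m → E𝕏 m ≡ prodList (primesUpTo m) (λ q → expect (dist q) (λ v → v ^ℚ mult q m))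
E𝕏-prodList m = trans (expectOver-cong (primesUpTo m) (λ f → Xval-prodList f m))
                      (expectOver-prodList (primesUpTo m) (primesUpTo-unique m) (λ q v → v ^ℚ mult q m))

∈-primesUpTo⁺ : ∀ {n x} → Prime x → x ≤ n → x ∈ primesUpTo n
∈-primesUpTo⁺ px x≤n = ∈-filter⁺ prime? (∈-upTo⁺ (s≤s x≤n)) px

∈-primesUpTo⁻ : ∀ {n x} → x ∈ primesUpTo n → Prime x
∈-primesUpTo⁻ {n} x∈ = proj₂ (∈-filter⁻ prime? {xs = upTo (suc n)} x∈)

prodList-primesUpTo : ∀ n .{{_ : NonZero n}} {ps} h → Unique ps → (∀ {x} → x ∈ ps → Prime x) →
                      (∀ {x} → Prime x → x ∣ n → x ∈ ps) → (∀ {x} → Prime x → ¬ x ∣ n → h x ≡ 1ℚ) →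
                      prodList (primesUpTo n) h ≡ prodList ps h
prodList-primesUpTo n h ups ps-prime ps-complete h≡1 =
  prodList-reindex (primesUpTo n) h (primesUpTo-unique n) ups onlyPrimes onlyPs
  where
  onlyPrimes : ∀ {x} → x ∈ primesUpTo n → x ∉ _ → h x ≡ 1ℚ
  onlyPrimes x∈ x∉ps = h≡1 (∈-primesUpTo⁻ {n} x∈) (x∉ps ∘ ps-complete (∈-primesUpTo⁻ {n} x∈))
  onlyPs : ∀ {y} → y ∈ _ → y ∉ primesUpTo n → h y ≡ 1ℚ
  onlyPs y∈ y∉ = h≡1 (ps-prime y∈) (y∉ ∘ ∈-primesUpTo⁺ (ps-prime y∈) ∘ ∣⇒≤)

prime⇒≥2 : ∀ {p} → Prime p → 2 ≤ p
prime⇒≥2 {p} pp = nonTrivial⇒n>1 p {{prime⇒nonTrivial pp}}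

prime∤1 : ∀ {p} → Prime p → ¬ p ∣ 1
prime∤1 pp p∣1 = ℕP.<⇒≢ (prime⇒≥2 pp) (sym (∣1⇒≡1 p∣1))

prime∣prime⇒≡ : ∀ {p q} → Prime p → Prime q → p ∣ q → p ≡ q
prime∣prime⇒≡ pp pq p∣q with prime⇒irreducible pq p∣q
... | inj₁ p≡1 = ⊥-elim (prime∤1 pp (∣-reflexive p≡1))
... | inj₂ p≡q = p≡q

prime∣^⇒∣ : ∀ {p x} → Prime p → ∀ a → p ∣ x ^ a → p ∣ x
prime∣^⇒∣ pp zero    p∣1 = ⊥-elim (prime∤1 pp p∣1)
prime∣^⇒∣ {x = x} pp (suc a) p∣x^1+a with euclidsLemma x (x ^ a) pp p∣x^1+a
... | inj₁ p∣x   = p∣x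
... | inj₂ p∣x^a = prime∣^⇒∣ pp a p∣x^a

prime∣prodℕ⇒∣factor : ∀ {p} → Prime p → ∀ k (g : Fin k → ℕ) → p ∣ prodℕ k g → ∃[ i ] p ∣ g i
prime∣prodℕ⇒∣factor pp zero    g p∣1 = ⊥-elim (prime∤1 pp p∣1)
prime∣prodℕ⇒∣factor pp (suc k) g p∣∏ with euclidsLemma (g zero) (prodℕ k (g ∘ suc)) pp p∣∏
... | inj₁ p∣g₀ = zero , p∣g₀
... | inj₂ p∣∏′ with prime∣prodℕ⇒∣factor pp k (g ∘ suc) p∣∏′
...   | i , p∣gᵢ = suc i , p∣gᵢ

factor∣prodℕ : ∀ k (g : Fin k → ℕ) j → g j ∣ prodℕ k g
factor∣prodℕ (suc k) g zero    = m∣m*n _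
factor∣prodℕ (suc k) g (suc j) = ∣n⇒∣m*n (g zero) (factor∣prodℕ k (g ∘ suc) j)

prodℕ-split : ∀ k (g : Fin k → ℕ) j → ∃[ R ] prodℕ k g ≡ g j * R ×
              (∀ {p} → Prime p → p ∣ R → ∃[ i ] i ≢ j × p ∣ g i)
prodℕ-split (suc k) g zero = prodℕ k (g ∘ suc) , refl , λ pp p∣R →
  let (i , p∣gᵢ) = prime∣prodℕ⇒∣factor pp k (g ∘ suc) p∣R in suc i , (λ ()) , p∣gᵢ
prodℕ-split (suc k) g (suc j) with prodℕ-split k (g ∘ suc) j
... | R , ∏≡ , R-factors = g zero * R , ∏≡′ , R′-factors
  where
  ∏≡′ : g zero * prodℕ k (g ∘ suc) ≡ g (suc j) * (g zero * R)
  ∏≡′ = trans (cong (g zero *_) ∏≡) (x∙yz≈y∙xz (g zero) (g (suc j)) R)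
  R′-factors : ∀ {p} → Prime p → p ∣ g zero * R → ∃[ i ] i ≢ suc j × p ∣ g i
  R′-factors pp p∣R′ with euclidsLemma (g zero) R pp p∣R′
  ... | inj₁ p∣g₀ = zero , (λ ()) , p∣g₀
  ... | inj₂ p∣R with R-factors pp p∣R
  ...   | i , i≢j , p∣gᵢ = suc i , i≢j ∘ FinP.suc-injective , p∣gᵢ

prodℕ-nonZero : ∀ k (g : Fin k → ℕ) → (∀ j → NonZero (g j)) → NonZero (prodℕ k g)
prodℕ-nonZero zero    g _       = _
prodℕ-nonZero (suc k) g g≢0 = ℕP.m*n≢0 (g zero) (prodℕ k (g ∘ suc)) {{g≢0 zero}} {{prodℕ-nonZero k (g ∘ suc) (g≢0 ∘ suc)}}

Multiplicity : ℕ → ℕ → ℕ → Set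
Multiplicity q n r = q ^ r ∣ n × ¬ q ^ suc r ∣ n

^-monoʳ-∣ : ∀ q {a b} → a ≤ b → q ^ a ∣ q ^ b
^-monoʳ-∣ q {zero}  {b}     _         = 1∣ _
^-monoʳ-∣ q {suc a} {suc b} (s≤s a≤b) = *-monoʳ-∣ q (^-monoʳ-∣ q a≤b)

multiplicity-unique : ∀ {q n r s} → Multiplicity q n r → Multiplicity q n s → r ≡ s
multiplicity-unique {q} {n} {r} {s} (q^r∣n , q^1+r∤n) (q^s∣n , q^1+s∤n) with ℕP.<-cmp r s
... | tri< r<s _ _ = ⊥-elim (q^1+r∤n (∣-trans (^-monoʳ-∣ q r<s) q^s∣n))
... | tri≈ _ r≡s _ = r≡s
... | tri> _ _ s<r = ⊥-elim (q^1+s∤n (∣-trans (^-monoʳ-∣ q s<r) q^r∣n))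

nonZero-of-∤ : ∀ {q n} → ¬ q ∣ n → NonZero n
nonZero-of-∤ {n = zero}  q∤0 = ⊥-elim (q∤0 (_ ∣0))
nonZero-of-∤ {n = suc n} _   = _

multiplicity-∤ : ∀ {q n} → ¬ q ∣ n → Multiplicity q n 0
multiplicity-∤ {q} {n} q∤n = 1∣ n , q∤n ∘ subst (_∣ n) (ℕP.*-identityʳ q)

multAux-multiplicity : ∀ q′ f n .{{_ : NonZero n}} → n ≤ f →
                       Multiplicity (suc (suc q′)) n (multAux f (suc (suc q′)) n)
multAux-multiplicity q′ (suc f) n@(suc n′) (s≤s n′≤f) =
  if-dec (q ∣? n) (Multiplicity q n) q∣n⇒multiplicity multiplicity-∤
  where
  q = suc (suc q′)
  d = n / q
  r = multAux f q d
  q∣n⇒multiplicity : q ∣ n → Multiplicity q n (suc r)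
  q∣n⇒multiplicity q∣n = subst (q ^ suc r ∣_) qd≡n (*-monoʳ-∣ q q^r∣d)
                       , λ q^2+r∣n → q^1+r∤d (*-cancelˡ-∣ q (subst (q ^ suc (suc r) ∣_) (sym qd≡n) q^2+r∣n))
    where
    qd≡n : q * d ≡ n
    qd≡n = m*[n/m]≡n q∣n
    instance
      d≢0 : NonZero d
      d≢0 = ℕP.m*n≢0⇒n≢0 q {{subst NonZero (sym qd≡n) _}}
    ih : Multiplicity q d r
    ih = multAux-multiplicity q′ f d (ℕP.≤-trans (ℕP.≤-pred (m/n<m n q (s≤s (s≤s z≤n)))) n′≤f)
    q^r∣d = proj₁ ih
    q^1+r∤d = proj₂ ih

mult-≡ : ∀ {q n r} → 2 ≤ q → .{{_ : NonZero n}} → Multiplicity q n r → mult q n ≡ r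
mult-≡ {suc (suc q′)} {n} (s≤s (s≤s _)) mul =
  multiplicity-unique (multAux-multiplicity q′ n n ℕP.≤-refl) mul

mult-^* : ∀ {q R} → 2 ≤ q → ¬ q ∣ R → ∀ a → mult q (q ^ a * R) ≡ a
mult-^* {q} {R} q≥2 q∤R a = mult-≡ q≥2 {{ℕP.m*n≢0 (q ^ a) R}} (m∣m*n R , q^1+a∤q^aR)
  where
  instance
    q≢0 : NonZero q
    q≢0 = >-nonZero (ℕP.<-trans (s≤s z≤n) q≥2)
    q^a≢0 : NonZero (q ^ a)
    q^a≢0 = ℕP.m^n≢0 q a
    R≢0 : NonZero R
    R≢0 = nonZero-of-∤ q∤R
  q^1+a∤q^aR : ¬ q ^ suc a ∣ q ^ a * R
  q^1+a∤q^aR q^1+a∣ = q∤R (*-cancelˡ-∣ (q ^ a) (subst (_∣ q ^ a * R) (ℕP.*-comm q (q ^ a)) q^1+a∣))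

mult-∤ : ∀ {q n} → 2 ≤ q → ¬ q ∣ n → mult q n ≡ 0
mult-∤ q≥2 q∤n = mult-≡ q≥2 {{nonZero-of-∤ q∤n}} (multiplicity-∤ q∤n)

1^ℚ : ∀ n → 1ℚ ^ℚ n ≡ 1ℚ
1^ℚ zero    = refl
1^ℚ (suc n) = cong (1ℚ Q.*_) (1^ℚ n)

0^ℚ : ∀ n .{{_ : NonZero n}} → 0ℚ ^ℚ n ≡ 0ℚ
0^ℚ (suc n) = QP.*-zeroˡ (0ℚ ^ℚ n)

2∣2+n⇔2∣n : ∀ {n} → (2 ∣ 2 + n → 2 ∣ n) × (2 ∣ n → 2 ∣ 2 + n)
2∣2+n⇔2∣n = (λ 2∣2+n → ∣m+n∣m⇒∣n 2∣2+n ∣-refl) , ∣m∣n⇒∣m+n ∣-refl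

-1^ℚ-even : ∀ n → 2 ∣ n → (- 1ℚ) ^ℚ n ≡ 1ℚ
-1^ℚ-even zero          _    = refl
-1^ℚ-even (suc zero)    2∣1  = ⊥-elim (prime∤1 prime[2] 2∣1)
-1^ℚ-even (suc (suc n)) 2∣n′ rewrite -1^ℚ-even n (proj₁ 2∣2+n⇔2∣n 2∣n′) = refl

-1^ℚ-odd : ∀ n → ¬ 2 ∣ n → (- 1ℚ) ^ℚ n ≡ - 1ℚ
-1^ℚ-odd zero          2∤0  = ⊥-elim (2∤0 (2 ∣0))
-1^ℚ-odd (suc zero)    _    = refl
-1^ℚ-odd (suc (suc n)) 2∤n′ rewrite -1^ℚ-odd n (2∤n′ ∘ proj₂ 2∣2+n⇔2∣n) = refl

-1^ℚ-length-filter : ∀ {P : ℕ → Set} (P? : Decidable P) xs →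
  (- 1ℚ) ^ℚ length (filter P? xs) ≡ prodList xs (λ x → if does (P? x) then - 1ℚ else 1ℚ)
-1^ℚ-length-filter P? []       = refl
-1^ℚ-length-filter P? (x ∷ xs) with does (P? x)
... | true  = cong (- 1ℚ Q.*_) (-1^ℚ-length-filter P? xs)
... | false = trans (-1^ℚ-length-filter P? xs) (sym (QP.*-identityˡ _))

prodFin-cong : ∀ k {f g : Fin k → ℚ} → (∀ j → f j ≡ g j) → prodFin k f ≡ prodFin k g
prodFin-cong zero    f≡g = refl
prodFin-cong (suc k) f≡g = cong₂ Q._*_ (f≡g zero) (prodFin-cong k (f≡g ∘ suc))

prodFin-* : ∀ k (f g : Fin k → ℚ) → prodFin k f Q.* prodFin k g ≡ prodFin k (λ j → f j Q.* g j)
prodFin-* zero    f g = refl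
prodFin-* (suc k) f g = begin
  (f zero Q.* F) Q.* (g zero Q.* G)  ≡⟨ solve 4 (λ a b c d → (a :* b) :* (c :* d) := (a :* c) :* (b :* d)) refl (f zero) F (g zero) G ⟩
  (f zero Q.* g zero) Q.* (F Q.* G)  ≡⟨ cong (f zero Q.* g zero Q.*_) (prodFin-* k (f ∘ suc) (g ∘ suc)) ⟩
  (f zero Q.* g zero) Q.* prodFin k (λ j → f (suc j) Q.* g (suc j)) ∎
  where
  open ≡-Reasoning
  F = prodFin k (f ∘ suc)
  G = prodFin k (g ∘ suc)

ℕ→ℚ-* : ∀ a b → ℕ→ℚ (a * b) ≡ ℕ→ℚ a Q.* ℕ→ℚ b
ℕ→ℚ-* a b = sym (trans (cong₂ Q._*_ (as-mkℚ a) (as-mkℚ b)) (cong (Q._/ 1) (ℤP.+◃n≡+n (a * b))))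
  where
  as-mkℚ : ∀ n → ℕ→ℚ n ≡ mkℚ (+ n) 0 (Coprime.sym (Coprime.1-coprimeTo n))
  as-mkℚ n = QP.normalize-coprime (Coprime.sym (Coprime.1-coprimeTo n))

*-inv : ∀ {x} → x ≢ 0ℚ → x Q.* inv x ≡ 1ℚ
*-inv {x} x≢0 with x Q.≟ 0ℚ
... | yes x≡0  = ⊥-elim (x≢0 x≡0)
... | no  x≢0′ = QP.*-inverseʳ x {{Q.≢-nonZero x≢0′}}

inv-unique : ∀ {x y} → x Q.* y ≡ 1ℚ → inv x ≡ y
inv-unique {x} {y} xy≡1 = begin
  inv x                ≡⟨ QP.*-identityʳ (inv x) ⟨
  inv x Q.* 1ℚ         ≡⟨ cong (inv x Q.*_) xy≡1 ⟨
  inv x Q.* (x Q.* y)  ≡⟨ solve 3 (λ i x y → i :* (x :* y) := (x :* i) :* y) refl (inv x) x y ⟩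
  (x Q.* inv x) Q.* y  ≡⟨ cong (Q._* y) (*-inv x≢0) ⟩
  1ℚ Q.* y             ≡⟨ QP.*-identityˡ y ⟩
  y                    ∎
  where
  open ≡-Reasoning
  x≢0 : x ≢ 0ℚ
  x≢0 refl = QP.1≢0 (trans (sym xy≡1) (QP.*-zeroˡ y))

inv-* : ∀ x y → inv (x Q.* y) ≡ inv x Q.* inv y
inv-* x y = by-cases (x Q.≟ 0ℚ) (y Q.≟ 0ℚ)
  where
  open ≡-Reasoning
  by-cases : Dec (x ≡ 0ℚ) → Dec (y ≡ 0ℚ) → inv (x Q.* y) ≡ inv x Q.* inv y
  by-cases (yes refl) _          = trans (cong inv (QP.*-zeroˡ y)) (sym (QP.*-zeroˡ (inv y)))
  by-cases (no _)     (yes refl) = trans (cong inv (QP.*-zeroʳ x)) (sym (QP.*-zeroʳ (inv x)))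
  by-cases (no x≢0)   (no y≢0)   = inv-unique {x Q.* y} (begin
    (x Q.* y) Q.* (inv x Q.* inv y)    ≡⟨ solve 4 (λ x y i j → (x :* y) :* (i :* j) := (x :* i) :* (y :* j)) refl x y (inv x) (inv y) ⟩
    (x Q.* inv x) Q.* (y Q.* inv y)    ≡⟨ cong₂ Q._*_ (*-inv x≢0) (*-inv y≢0) ⟩
    1ℚ                                 ∎)

inv-ℕ→ℚ-prodℕ : ∀ k g → inv (ℕ→ℚ (prodℕ k g)) ≡ prodFin k (λ j → inv (ℕ→ℚ (g j)))
inv-ℕ→ℚ-prodℕ zero    g = refl
inv-ℕ→ℚ-prodℕ (suc k) g = begin
  inv (ℕ→ℚ (g zero * prodℕ k (g ∘ suc)))                 ≡⟨ cong inv (ℕ→ℚ-* (g zero) _) ⟩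
  inv (ℕ→ℚ (g zero) Q.* ℕ→ℚ (prodℕ k (g ∘ suc)))         ≡⟨ inv-* (ℕ→ℚ (g zero)) _ ⟩
  inv (ℕ→ℚ (g zero)) Q.* inv (ℕ→ℚ (prodℕ k (g ∘ suc)))   ≡⟨ cong (inv (ℕ→ℚ (g zero)) Q.*_) (inv-ℕ→ℚ-prodℕ k (g ∘ suc)) ⟩
  prodFin (suc k) (λ j → inv (ℕ→ℚ (g j)))                ∎
  where open ≡-Reasoning

normaliser : ℕ → ℚ
normaliser q = inv (1ℚ - cℚ q Q.* inv (ℕ→ℚ (q ^ 2)))

dist-≢2 : ∀ {q} → q ≢ 2 → dist q ≡ (1ℚ , αp q) ∷ (- 1ℚ , βp q) ∷ (0ℚ , γp q) ∷ []
dist-≢2 {0}                 _   = refl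
dist-≢2 {1}                 _   = refl
dist-≢2 {2}                 q≢2 = ⊥-elim (q≢2 refl)
dist-≢2 {suc (suc (suc _))} _   = refl

expect-dist-≢2 : ∀ {q} → q ≢ 2 → ∀ K →
                 expect (dist q) K ≡ αp q Q.* K 1ℚ Q.+ (βp q Q.* K (- 1ℚ) Q.+ (γp q Q.* K 0ℚ Q.+ 0ℚ))
expect-dist-≢2 q≢2 K = cong (λ law → expect law K) (dist-≢2 q≢2)

expect-dist-^0 : ∀ q → expect (dist q) (_^ℚ 0) ≡ 1ℚ
expect-dist-^0 q with q ℕP.≟ 2
... | yes refl = refl
... | no q≢2   = trans (expect-dist-≢2 q≢2 (_^ℚ 0))
  (solve 2 (λ α β → α :* con 1ℚ :+ (β :* con 1ℚ :+ ((con 1ℚ :- α :- β) :* con 1ℚ :+ con 0ℚ)) := con 1ℚ)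
         refl (αp q) (βp q))

expect-dist2-^ : ∀ ℓ → expect (dist 2) (_^ℚ ℓ) ≡ ½ Q.* 1ℚ Q.+ (½ Q.* ((- 1ℚ) ^ℚ ℓ) Q.+ 0ℚ)
expect-dist2-^ ℓ = cong (λ x → ½ Q.* x Q.+ (½ Q.* ((- 1ℚ) ^ℚ ℓ) Q.+ 0ℚ)) (1^ℚ ℓ)

expect-dist2-even : ∀ {ℓ} → 2 ∣ ℓ → expect (dist 2) (_^ℚ ℓ) ≡ 1ℚ
expect-dist2-even {ℓ} 2∣ℓ = trans (expect-dist2-^ ℓ) (cong (λ s → ½ Q.* 1ℚ Q.+ (½ Q.* s Q.+ 0ℚ)) (-1^ℚ-even ℓ 2∣ℓ))

expect-dist2-odd : ∀ {ℓ} → ¬ 2 ∣ ℓ → expect (dist 2) (_^ℚ ℓ) ≡ 0ℚ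
expect-dist2-odd {ℓ} 2∤ℓ = trans (expect-dist2-^ ℓ) (cong (λ s → ½ Q.* 1ℚ Q.+ (½ Q.* s Q.+ 0ℚ)) (-1^ℚ-odd ℓ 2∤ℓ))

expect-dist-^ : ∀ {q} a .{{a≢0 : NonZero a}} → q ≢ 2 →
                expect (dist q) (_^ℚ a) ≡ αp q Q.+ βp q Q.* ((- 1ℚ) ^ℚ a)
expect-dist-^ {q} a {{a≢0}} q≢2 = begin
  expect (dist q) (_^ℚ a)
    ≡⟨ expect-dist-≢2 q≢2 (_^ℚ a) ⟩
  αp q Q.* (1ℚ ^ℚ a) Q.+ (βp q Q.* s Q.+ (γp q Q.* (0ℚ ^ℚ a) Q.+ 0ℚ))
    ≡⟨ cong₂ (λ x y → αp q Q.* x Q.+ (βp q Q.* s Q.+ (γp q Q.* y Q.+ 0ℚ))) (1^ℚ a) (0^ℚ a {{a≢0}}) ⟩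
  αp q Q.* 1ℚ Q.+ (βp q Q.* s Q.+ (γp q Q.* 0ℚ Q.+ 0ℚ))
    ≡⟨ solve 4 (λ α β γ s → α :* con 1ℚ :+ (β :* s :+ (γ :* con 0ℚ :+ con 0ℚ)) := α :+ β :* s) refl (αp q) (βp q) (γp q) s ⟩
  αp q Q.+ βp q Q.* s ∎
  where
  open ≡-Reasoning
  s = (- 1ℚ) ^ℚ a

-- In the last steps of the next two proofs, αp q and βp q unfold to the
-- left-hand side of the solver equation.
expect-dist-^-even : ∀ {q} a .{{_ : NonZero a}} → q ≢ 2 → 2 ∣ a →
                     expect (dist q) (_^ℚ a) ≡ (1ℚ - cℚ q Q.* inv (ℕ→ℚ q)) Q.* normaliser q
expect-dist-^-even {q} a q≢2 2∣a = begin
  expect (dist q) (_^ℚ a)          ≡⟨ expect-dist-^ a q≢2 ⟩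
  αp q Q.+ βp q Q.* ((- 1ℚ) ^ℚ a)  ≡⟨ cong (λ s → αp q Q.+ βp q Q.* s) (-1^ℚ-even a 2∣a) ⟩
  αp q Q.+ βp q Q.* 1ℚ             ≡⟨ solve 3 (λ c i D → con ½ :* (con 1ℚ :- (c :+ con 1ℚ) :* i) :* D
                                                         :+ con ½ :* (con 1ℚ :- (c :- con 1ℚ) :* i) :* D :* con 1ℚ
                                                         := (con 1ℚ :- c :* i) :* D)
                                            refl (cℚ q) (inv (ℕ→ℚ q)) (normaliser q) ⟩
  (1ℚ - cℚ q Q.* inv (ℕ→ℚ q)) Q.* normaliser q ∎
  where open ≡-Reasoning

expect-dist-^-odd : ∀ {q} a → q ≢ 2 → ¬ 2 ∣ a →
                    expect (dist q) (_^ℚ a) ≡ - inv (ℕ→ℚ q) Q.* normaliser q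
expect-dist-^-odd {q} a q≢2 2∤a = begin
  expect (dist q) (_^ℚ a)          ≡⟨ expect-dist-^ a {{nonZero-of-∤ 2∤a}} q≢2 ⟩
  αp q Q.+ βp q Q.* ((- 1ℚ) ^ℚ a)  ≡⟨ cong (λ s → αp q Q.+ βp q Q.* s) (-1^ℚ-odd a 2∤a) ⟩
  αp q Q.+ βp q Q.* (- 1ℚ)         ≡⟨ solve 3 (λ c i D → con ½ :* (con 1ℚ :- (c :+ con 1ℚ) :* i) :* D
                                                         :+ con ½ :* (con 1ℚ :- (c :- con 1ℚ) :* i) :* D :* (:- con 1ℚ)
                                                         := (:- i) :* D)
                                            refl (cℚ q) (inv (ℕ→ℚ q)) (normaliser q) ⟩
  - inv (ℕ→ℚ q) Q.* normaliser q   ∎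
  where open ≡-Reasoning

module _ (ℓ k : ℕ) (p : Fin k → ℕ) (a : Fin k → ℕ)
         (p-prime : ∀ j → Prime (p j)) (p-odd : ∀ j → ¬ 2 ∣ p j) (p-injective : Injective _≡_ _≡_ p)
         (a≥1 : ∀ j → 1 ≤ a j) where

  private
    g₀ : Fin k → ℕ
    g₀ j = if does (2 ∣? a j) then 1 else p j

    P m₀ m : ℕ
    P  = prodℕ k (λ j → p j ^ a j)
    m  = 2 ^ ℓ * P
    m₀ = prodℕ k g₀

    instance
      p≢0 : ∀ {j} → NonZero (p j)
      p≢0 {j} = prime⇒nonZero (p-prime j)
      P≢0 : NonZero P
      P≢0 = prodℕ-nonZero k _ (λ j → ℕP.m^n≢0 (p j) (a j))
      m≢0 : NonZero m
      m≢0 = ℕP.m*n≢0 (2 ^ ℓ) P {{ℕP.m^n≢0 2 ℓ}}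

    p≢2 : ∀ j → p j ≢ 2
    p≢2 j p≡2 = p-odd j (∣-reflexive (sym p≡2))

    prime∣p^⇒≡ : ∀ {x} j → Prime x → x ∣ p j ^ a j → x ≡ p j
    prime∣p^⇒≡ j px x∣ = prime∣prime⇒≡ px (p-prime j) (prime∣^⇒∣ px (a j) x∣)

    prime∣P⇒≡p : ∀ {x} → Prime x → x ∣ P → ∃[ j ] x ≡ p j
    prime∣P⇒≡p px x∣P with prime∣prodℕ⇒∣factor px k _ x∣P
    ... | j , x∣p^ = j , prime∣p^⇒≡ j px x∣p^

    prime∣m⇒∈ : ∀ {x} → Prime x → x ∣ m → x ∈ 2 ∷ tabulate p
    prime∣m⇒∈ px x∣m with euclidsLemma (2 ^ ℓ) P px x∣m
    ... | inj₁ x∣2^ℓ = here (prime∣prime⇒≡ px prime[2] (prime∣^⇒∣ px ℓ x∣2^ℓ))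
    ... | inj₂ x∣P with prime∣P⇒≡p px x∣P
    ...   | j , refl = there (∈-tabulate⁺ j)

    mult-2 : mult 2 m ≡ ℓ
    mult-2 = mult-^* ℕP.≤-refl 2∤P ℓ
      where
      2∤P : ¬ 2 ∣ P
      2∤P 2∣P with prime∣P⇒≡p prime[2] 2∣P
      ... | j , 2≡p = p≢2 j (sym 2≡p)

    mult-p : ∀ j → mult (p j) m ≡ a j
    mult-p j with prodℕ-split k (λ i → p i ^ a i) j
    ... | R , P≡ , R-factors = begin
      mult (p j) (2 ^ ℓ * P)                   ≡⟨ cong (λ n → mult (p j) (2 ^ ℓ * n)) P≡ ⟩
      mult (p j) (2 ^ ℓ * (p j ^ a j * R))     ≡⟨ cong (mult (p j)) (x∙yz≈y∙xz (2 ^ ℓ) (p j ^ a j) R) ⟩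
      mult (p j) (p j ^ a j * (2 ^ ℓ * R))     ≡⟨ mult-^* (prime⇒≥2 (p-prime j)) p∤2^ℓR (a j) ⟩
      a j                                      ∎
      where
      open ≡-Reasoning
      p∤2^ℓR : ¬ p j ∣ 2 ^ ℓ * R
      p∤2^ℓR p∣ with euclidsLemma (2 ^ ℓ) R (p-prime j) p∣
      ... | inj₁ p∣2^ℓ = p≢2 j (prime∣prime⇒≡ (p-prime j) prime[2] (prime∣^⇒∣ (p-prime j) ℓ p∣2^ℓ))
      ... | inj₂ p∣R with R-factors (p-prime j) p∣R
      ...   | i , i≢j , p∣p^ = i≢j (sym (p-injective (prime∣p^⇒≡ i (p-prime j) p∣p^)))

    E : ℕ → ℚ
    E q = expect (dist q) (_^ℚ mult q m)

    E𝕏-factors : E𝕏 m ≡ E 2 Q.* prodFin k (λ j → E (p j))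
    E𝕏-factors = begin
      E𝕏 m                                    ≡⟨ E𝕏-prodList m ⟩
      prodList (primesUpTo m) E               ≡⟨ prodList-primesUpTo m E unique prime prime∣m⇒∈ E≡1 ⟩
      E 2 Q.* prodList (tabulate p) E         ≡⟨ cong (E 2 Q.*_) (prodList-tabulate k p E) ⟩
      E 2 Q.* prodFin k (λ j → E (p j))       ∎
      where
      open ≡-Reasoning
      unique : Unique (2 ∷ tabulate p)
      unique = AllP.tabulate⁺ (λ j → p≢2 j ∘ sym) ∷ UniqueP.tabulate⁺ p-injective
      prime : ∀ {x} → x ∈ 2 ∷ tabulate p → Prime x
      prime (here refl) = prime[2]
      prime (there x∈) with ∈-tabulate⁻ x∈
      ... | j , refl = p-prime j
      E≡1 : ∀ {x} → Prime x → ¬ x ∣ m → E x ≡ 1ℚ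
      E≡1 {x} px x∤m rewrite mult-∤ (prime⇒≥2 px) x∤m = expect-dist-^0 x

    g₀-cases : ∀ i → (2 ∣ a i × g₀ i ≡ 1) ⊎ (¬ 2 ∣ a i × g₀ i ≡ p i)
    g₀-cases i = if-dec (2 ∣? a i) (λ g → (2 ∣ a i × g ≡ 1) ⊎ (¬ 2 ∣ a i × g ≡ p i))
                        (λ 2∣aᵢ → inj₁ (2∣aᵢ , refl)) (λ 2∤aᵢ → inj₂ (2∤aᵢ , refl))

    A : Fin k → ℚ
    A j = if does (2 ∣? a j) then 1ℚ - cℚ (p j) Q.* inv (ℕ→ℚ (p j)) else 1ℚ

    sign : ℕ → ℚ
    sign x = if does (x ∣? m₀) then - 1ℚ else 1ℚ

    prime∣m₀⇒≡p : ∀ {x} → Prime x → x ∣ m₀ → ∃[ i ] x ≡ p i × ¬ 2 ∣ a i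
    prime∣m₀⇒≡p px x∣m₀ with prime∣prodℕ⇒∣factor px k g₀ x∣m₀
    ... | i , x∣g₀ with g₀-cases i
    ...   | inj₁ (_ , g₀≡1)    = ⊥-elim (prime∤1 px (subst (_ ∣_) g₀≡1 x∣g₀))
    ...   | inj₂ (2∤aᵢ , g₀≡p) = i , prime∣prime⇒≡ px (p-prime i) (subst (_ ∣_) g₀≡p x∣g₀) , 2∤aᵢ

    p∣m₀⇔odd : ∀ j → (p j ∣ m₀ → ¬ 2 ∣ a j) × (¬ 2 ∣ a j → p j ∣ m₀)
    p∣m₀⇔odd j = p∣m₀⇒odd , odd⇒p∣m₀
      where
      p∣m₀⇒odd : p j ∣ m₀ → ¬ 2 ∣ a j
      p∣m₀⇒odd p∣m₀ with prime∣m₀⇒≡p (p-prime j) p∣m₀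
      ... | i , pⱼ≡pᵢ , 2∤aᵢ = subst (λ i → ¬ 2 ∣ a i) (sym (p-injective pⱼ≡pᵢ)) 2∤aᵢ
      odd⇒p∣m₀ : ¬ 2 ∣ a j → p j ∣ m₀
      odd⇒p∣m₀ 2∤aⱼ with g₀-cases j
      ... | inj₁ (2∣aⱼ , _) = ⊥-elim (2∤aⱼ 2∣aⱼ)
      ... | inj₂ (_ , g₀≡p) = subst (_∣ m₀) g₀≡p (factor∣prodℕ k g₀ j)

    -1^ω-m₀ : (- 1ℚ) ^ℚ ω m₀ ≡ prodFin k (sign ∘ p)
    -1^ω-m₀ = begin
      (- 1ℚ) ^ℚ ω m₀                                ≡⟨ -1^ℚ-length-filter (_∣? m₀) (primesUpTo m₀) ⟩
      prodList (primesUpTo m₀) sign                 ≡⟨ prodList-primesUpTo m₀ {{m₀≢0}} sign (UniqueP.tabulate⁺ p-injective) prime prime∣m₀⇒∈ sign≡1 ⟩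
      prodList (tabulate p) sign                    ≡⟨ prodList-tabulate k p sign ⟩
      prodFin k (sign ∘ p)                          ∎
      where
      open ≡-Reasoning
      m₀≢0 : NonZero m₀
      m₀≢0 = prodℕ-nonZero k g₀ (λ j → if-dec (2 ∣? a j) NonZero (λ _ → _) (λ _ → p≢0 {j}))
      prime : ∀ {x} → x ∈ tabulate p → Prime x
      prime x∈ with ∈-tabulate⁻ x∈
      ... | j , refl = p-prime j
      prime∣m₀⇒∈ : ∀ {x} → Prime x → x ∣ m₀ → x ∈ tabulate p
      prime∣m₀⇒∈ px x∣m₀ with prime∣m₀⇒≡p px x∣m₀
      ... | i , refl , _ = ∈-tabulate⁺ i
      sign≡1 : ∀ {x} → Prime x → ¬ x ∣ m₀ → sign x ≡ 1ℚ
      sign≡1 {x} _ x∤m₀ = if-dec (x ∣? m₀) (_≡ 1ℚ) (⊥-elim ∘ x∤m₀) (λ _ → refl)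

    sign-p-even : ∀ j → 2 ∣ a j → sign (p j) ≡ 1ℚ
    sign-p-even j 2∣aⱼ = if-dec (p j ∣? m₀) (_≡ 1ℚ) (λ p∣m₀ → ⊥-elim (proj₁ (p∣m₀⇔odd j) p∣m₀ 2∣aⱼ)) (λ _ → refl)

    sign-p-odd : ∀ j → ¬ 2 ∣ a j → sign (p j) ≡ - 1ℚ
    sign-p-odd j 2∤aⱼ = if-dec (p j ∣? m₀) (_≡ - 1ℚ) (λ _ → refl) (λ p∤m₀ → ⊥-elim (p∤m₀ (proj₂ (p∣m₀⇔odd j) 2∤aⱼ)))

    E-2 : E 2 ≡ expect (dist 2) (_^ℚ ℓ)
    E-2 = cong (λ n → expect (dist 2) (_^ℚ n)) mult-2

    local-factor : Fin k → ℚ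
    local-factor j = inv (ℕ→ℚ (g₀ j)) Q.* sign (p j) Q.* A j Q.* normaliser (p j)

    E-p : ∀ j → E (p j) ≡ local-factor j
    E-p j = trans (cong (λ n → expect (dist (p j)) (_^ℚ n)) (mult-p j)) (by-parity (2 ∣? a j))
      where
      open ≡-Reasoning
      N = normaliser (p j)
      i = inv (ℕ→ℚ (p j))
      -- Abstracting over the decision lets `g₀ j` and `A j` reduce together.
      by-parity : (d : Dec (2 ∣ a j)) → expect (dist (p j)) (_^ℚ a j) ≡
        inv (ℕ→ℚ (if does d then 1 else p j)) Q.* sign (p j) Q.* (if does d then 1ℚ - cℚ (p j) Q.* i else 1ℚ) Q.* N
      by-parity (yes 2∣aⱼ) = begin
        expect (dist (p j)) (_^ℚ a j)              ≡⟨ expect-dist-^-even (a j) {{>-nonZero (a≥1 j)}} (p≢2 j) 2∣aⱼ ⟩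
        (1ℚ - cℚ (p j) Q.* i) Q.* N                ≡⟨ solve 2 (λ x N → x :* N := con 1ℚ :* con 1ℚ :* x :* N) refl (1ℚ - cℚ (p j) Q.* i) N ⟩
        1ℚ Q.* 1ℚ Q.* (1ℚ - cℚ (p j) Q.* i) Q.* N  ≡⟨ cong (λ s → 1ℚ Q.* s Q.* (1ℚ - cℚ (p j) Q.* i) Q.* N) (sign-p-even j 2∣aⱼ) ⟨
        1ℚ Q.* sign (p j) Q.* (1ℚ - cℚ (p j) Q.* i) Q.* N ∎
      by-parity (no 2∤aⱼ) = begin
        expect (dist (p j)) (_^ℚ a j)              ≡⟨ expect-dist-^-odd (a j) (p≢2 j) 2∤aⱼ ⟩
        - i Q.* N                                  ≡⟨ solve 2 (λ i N → (:- i) :* N := i :* (:- con 1ℚ) :* con 1ℚ :* N) refl i N ⟩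
        i Q.* (- 1ℚ) Q.* 1ℚ Q.* N                  ≡⟨ cong (λ s → i Q.* s Q.* 1ℚ Q.* N) (sign-p-odd j 2∤aⱼ) ⟨
        i Q.* sign (p j) Q.* 1ℚ Q.* N                     ∎

  E𝕏-odd : ¬ 2 ∣ ℓ → E𝕏 m ≡ 0ℚ
  E𝕏-odd 2∤ℓ = begin
    E𝕏 m                                    ≡⟨ E𝕏-factors ⟩
    E 2 Q.* prodFin k (λ j → E (p j))       ≡⟨ cong (Q._* prodFin k (λ j → E (p j))) (trans E-2 (expect-dist2-odd 2∤ℓ)) ⟩
    0ℚ Q.* prodFin k (λ j → E (p j))        ≡⟨ QP.*-zeroˡ (prodFin k (λ j → E (p j))) ⟩
    0ℚ                                      ∎
    where open ≡-Reasoning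

  E𝕏-even : 2 ∣ ℓ → E𝕏 m ≡ inv (ℕ→ℚ m₀) Q.* ((- 1ℚ) ^ℚ ω m₀) Q.* prodFin k A Q.* prodFin k (normaliser ∘ p)
  E𝕏-even 2∣ℓ = begin
    E𝕏 m                                                 ≡⟨ E𝕏-factors ⟩
    E 2 Q.* prodFin k (λ j → E (p j))                    ≡⟨ cong₂ Q._*_ (trans E-2 (expect-dist2-even 2∣ℓ)) (prodFin-cong k E-p) ⟩
    1ℚ Q.* prodFin k local-factor                        ≡⟨ QP.*-identityˡ _ ⟩
    prodFin k local-factor                               ≡⟨ prodFin-* k _ (normaliser ∘ p) ⟨
    prodFin k (λ j → Ig j Q.* sign (p j) Q.* A j) Q.* ∏N ≡⟨ cong (Q._* ∏N) (prodFin-* k _ A) ⟨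
    prodFin k (λ j → Ig j Q.* sign (p j)) Q.* ∏A Q.* ∏N  ≡⟨ cong (λ x → x Q.* ∏A Q.* ∏N) (prodFin-* k Ig (sign ∘ p)) ⟨
    prodFin k Ig Q.* prodFin k (sign ∘ p) Q.* ∏A Q.* ∏N  ≡⟨ cong₂ (λ x y → x Q.* y Q.* ∏A Q.* ∏N) (inv-ℕ→ℚ-prodℕ k g₀) -1^ω-m₀ ⟨
    inv (ℕ→ℚ m₀) Q.* ((- 1ℚ) ^ℚ ω m₀) Q.* ∏A Q.* ∏N     ∎
    where
    open ≡-Reasoning
    Ig = λ j → inv (ℕ→ℚ (g₀ j))
    ∏A = prodFin k A
    ∏N = prodFin k (normaliser ∘ p)

lemma2p2 : (ℓ k : ℕ) (p : Fin k → ℕ) (a : Fin k → ℕ) →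
  (∀ j → Prime (p j)) → (∀ j → ¬ (2 ∣ p j)) → Injective _≡_ _≡_ p →
  (∀ j → 1 ≤ a j) →
  let m = 2 ^ ℓ * prodℕ k (λ j → p j ^ a j)
      m₀ = prodℕ k (λ j → if does (2 ∣? a j) then 1 else p j)
  in (2 ∣ ℓ →
        E𝕏 m ≡ inv (ℕ→ℚ m₀) Q.* ((- 1ℚ) ^ℚ ω m₀)
               Q.* prodFin k (λ j → if does (2 ∣? a j)
                                     then 1ℚ - cℚ (p j) Q.* inv (ℕ→ℚ (p j))
                                     else 1ℚ)
               Q.* prodFin k (λ j → inv (1ℚ - cℚ (p j) Q.* inv (ℕ→ℚ (p j ^ 2)))))
   × (¬ (2 ∣ ℓ) → E𝕏 m ≡ 0ℚ)
lemma2p2 ℓ k p a p-prime p-odd p-injective a≥1 =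
  E𝕏-even ℓ k p a p-prime p-odd p-injective a≥1 , E𝕏-odd ℓ k p a p-prime p-odd p-injective a≥1
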